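{- Let $(\sigma,\eta):\mathcal{A}\to\mathcal{A}'$ be an open morphism of asynchronous systems. Then for every $n\ge 0$ the map $Q_n(\sigma,\eta):Q_n(\mathcal{A})\to Q_n(\mathcal{A}')$ is surjective.
   Context: A state space $(S,E,I,\mathrm{Tran})$: states $S$, events $E$, symmetric irreflexive independence $I\subseteq E\times E$, transitions $\mathrm{Tran}\subseteq S\times E\times S$, with (1) $(s,a,s'),(s,a,s'')\in\mathrm{Tran}\Rightarrow s'=s''$; (2) if $(a,b)\in I$, $(s,a,s'),(s',b,s'')\in\mathrm{Tran}$ then some $s_1$ has $(s,b,s_1),(s_1,a,s'')\in\mathrm{Tran}$. An asynchronous system $\mathcal{A}=(S,s_0,E,I,\mathrm{Tran})$ adds an initial state $s_0$, every event occurring in some transition. For a word $w=e_1\cdots e_k$ over $E$, $s\cdot w\in S$ means there are $s=t_0,\dots,t_k$ with $(t_{i-1},e_i,t_i)\in\mathrm{Tran}$, and $s\cdot w=t_k$. A state is reachable if it is $s_0\cdot w$ for some word $w$ (including the empty word). Let $Q_0(\mathcal{A})$ be the set of reachable states and for $n>0$, $Q_n(\mathcal{A})=\{(s,e_1,\dots,e_n)\in S\times E^n : s \text{ reachable},\ s\cdot e_1\cdots e_n\in S,\ (e_i,e_j)\in I \text{ for all } 1\le i<j\le n\}$. A morphism $(\sigma,\eta):\mathcal{A}\to\mathcal{A}'=(S',s'_0,E',I',\mathrm{Tran}')$: total $\sigma:S\to S'$ with $\sigma(s_0)=s'_0$, partial $\eta:E\rightharpoonup E'$, such that for each $(s_1,e,s_2)\in\mathrm{Tran}$,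 $(\sigma(s_1),\eta(e),\sigma(s_2))\in\mathrm{Tran}'$ if $\eta(e)$ is defined and $\sigma(s_1)=\sigma(s_2)$ otherwise, and $(\eta(e_1),\eta(e_2))\in I'$ for $(e_1,e_2)\in I$ with both defined. It is open if (a) $\eta$ is total; (b) for every $s\in S$ and $(\sigma(s),e',u')\in\mathrm{Tran}'$ there is $(s,e,u)\in\mathrm{Tran}$ with $\eta(e)=e'$, $\sigma(u)=u'$; (c) for every reachable $s$, if $(s,e_1,u),(u,e_2,v)\in\mathrm{Tran}$ and $(\eta(e_1),\eta(e_2))\in I'$ then $(e_1,e_2)\in I$. When $\eta$ is total, $Q_n(\sigma,\eta)(s,e_1,\dots,e_n)=(\sigma(s),\eta(e_1),\dots,\eta(e_n))$. -}

module Defs where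

open import Data.Nat using (ℕ)
open import Data.Fin using (Fin; _<_)
open import Data.Vec using (Vec; []; _∷_; lookup; map)
open import Data.List using (List; []; _∷_)
open import Data.Maybe using (Maybe; just; nothing)
open import Data.Product using (Σ; ∃; _×_; _,_)
open import Relation.Nullary using (¬_)
open import Relation.Binary.PropositionalEquality using (_≡_)

record AsyncSystem : Set₁ where
  field
    S     : Set
    s₀    : S
    E     : Set
    I     : E → E → Set
    Tran  : S → E → S → Set
    I-sym     : ∀ {a b} → I a b → I b a
    I-irrefl  : ∀ {a} → ¬ I a a
    determ    : ∀ {s a s' s''} → Tran s a s' → Tran s a s'' → s' ≡ s''
    diamond   : ∀ {a b s s' s''} → I a b → Tran s a s' → Tran s' b s'' →
                Σ S (λ s₁ → Tran s b s₁ × Tran s₁ a s'')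
    occurs    : ∀ (e : E) → Σ S (λ s → Σ S (λ u → Tran s e u))

  data Run : S → List E → S → Set where
    run-[] : ∀ {s} → Run s [] s
    run-∷  : ∀ {s e u w t} → Tran s e u → Run u w t → Run s (e ∷ w) t

  Defined : S → List E → Set
  Defined s w = Σ S (λ t → Run s w t)

  Reachable : S → Set
  Reachable s = Σ (List E) (λ w → Run s₀ w s)

  toList : ∀ {n} → Vec E n → List E
  toList []       = []
  toList (e ∷ es) = e ∷ toList es

  PairwiseIndep : ∀ {n} → Vec E n → Set
  PairwiseIndep {n} es = ∀ (i j : Fin n) → i < j → I (lookup es i) (lookup es j)

  InQ : (n : ℕ) → S → Vec E n → Set
  InQ n s es = Reachable s × Defined s (toList es) × PairwiseIndep es

open AsyncSystem

-- A morphism (σ, η) : A → A' with η partial (η e = nothing means undefined).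
record Morphism (A A' : AsyncSystem) : Set where
  field
    σ   : S A → S A'
    η   : E A → Maybe (E A')
    σ-init   : σ (s₀ A) ≡ s₀ A'
    tran-def : ∀ {s₁ e s₂ e'} → Tran A s₁ e s₂ → η e ≡ just e' →
               Tran A' (σ s₁) e' (σ s₂)
    tran-undef : ∀ {s₁ e s₂} → Tran A s₁ e s₂ → η e ≡ nothing → σ s₁ ≡ σ s₂
    indep : ∀ {e₁ e₂ e₁' e₂'} → I A e₁ e₂ → η e₁ ≡ just e₁' → η e₂ ≡ just e₂' →
            I A' e₁' e₂'

open Morphism

record IsOpen {A A' : AsyncSystem} (f : Morphism A A') : Set where
  field
    total : ∀ (e : E A) → Σ (E A') (λ e' → η f e ≡ just e')
    lift  : ∀ (s : S A) {e' u'} → Tran A' (σ f s) e' u' →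
            Σ (E A) (λ e → Σ (S A) (λ u → Tran A s e u × η f e ≡ just e' × σ f u ≡ u'))
    reflect : ∀ {s e₁ u e₂ v e₁' e₂'} → Reachable A s →
              Tran A s e₁ u → Tran A u e₂ v →
              η f e₁ ≡ just e₁' → η f e₂ ≡ just e₂' → I A' e₁' e₂' → I A e₁ e₂

-- Q_n(σ,η)(s, e₁…eₙ) = (σ s, η e₁ … η eₙ): surjectivity of Q_n(σ,η)
-- (η total, so η eᵢ ≡ just e'ᵢ expresses η(eᵢ) = e'ᵢ).
QSurjective : {A A' : AsyncSystem} → Morphism A A' → ℕ → Set
QSurjective {A} {A'} f n =
  ∀ (s' : S A') (es' : Vec (E A') n) → InQ A' n s' es' →
  Σ (S A) (λ s → Σ (Vec (E A) n) (λ es →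
    InQ A n s es × σ f s ≡ s' × map (η f) es ≡ map just es'))

-- Lift the reachable state s' along a run from s'₀ using the transition-lifting
-- condition (b), then lift the word e'₁ ⋯ e'ₙ from the lifted state the same way.
-- The lifted events are pairwise independent: for j = i + 1 this is the
-- reflection condition (c); for j > i + 1 the diamond property lets eᵢ commute
-- past the intermediate events (it is independent of each of them by induction)
-- until it is adjacent to eⱼ, and every intermediate source state stays reachable.
module Submission where

open import Defs
open import Data.Nat using (ℕ; s≤s; z≤n)
open import Data.Fin using (zero; suc)
open import Data.Vec using (Vec; []; _∷_; lookup; map; fromList)
open import Data.Vec.Properties using (∷-injective)
open import Data.List using (List; []; _∷_; _++_)
open import Data.Maybe using (just)
open import Data.Product using (Σ; _×_; _,_)
open import Relation.Binary.PropositionalEquality using (_≡_; refl; sym; cong; cong₂)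

module RunProperties (A : AsyncSystem) where
  open AsyncSystem A

  run-snoc : ∀ {s w t e u} → Run s w t → Tran t e u → Run s (w ++ e ∷ []) u
  run-snoc run-[]       tr = run-∷ tr run-[]
  run-snoc (run-∷ x r) tr = run-∷ x (run-snoc r tr)

  reachable-step : ∀ {s e u} → Reachable s → Tran s e u → Reachable u
  reachable-step (w , r) tr = w ++ _ ∷ [] , run-snoc r tr

  toList-fromList : (w : List E) → toList (fromList w) ≡ w
  toList-fromList []      = refl
  toList-fromList (e ∷ w) = cong (e ∷_) (toList-fromList w)

module OpenMorphism {A A' : AsyncSystem} {f : Morphism A A'} (op : IsOpen f) where
  open AsyncSystem A
  open RunProperties A
  module A' = AsyncSystem A'
  open RunProperties A' using () renaming (toList-fromList to toList-fromList')
  open Morphism f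
  open IsOpen op

  lift-run : ∀ {n} (s : S) {t' : A'.S} (es' : Vec A'.E n) → A'.Run (σ s) (A'.toList es') t' →
             Σ (Vec E n) λ es → Σ S λ t →
               Run s (toList es) t × σ t ≡ t' × map η es ≡ map just es'
  lift-run s []          A'.run-[]          = [] , s , run-[] , refl , refl
  lift-run s (e' ∷ es') (A'.run-∷ tr' r') with lift s tr'
  ... | e , u , tr , ηe , refl with lift-run u es' r'
  ... | es , t , r , σt , ηes = e ∷ es , t , run-∷ tr r , σt , cong₂ _∷_ ηe ηes

  lift-reachable : ∀ {s'} → A'.Reachable s' → Σ S λ s → Reachable s × σ s ≡ s'
  lift-reachable (w' , r') rewrite sym σ-init | sym (toList-fromList' w')
    with lift-run s₀ (fromList w') r'
  ... | es , s , r , σs , _ = s , (toList es , r) , σs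

  independent-of-run : ∀ {n s e u t e'} (ws : Vec E n) (ws' : Vec A'.E n) →
                       Reachable s → Tran s e u → Run u (toList ws) t →
                       η e ≡ just e' → map η ws ≡ map just ws' →
                       (∀ k → A'.I e' (lookup ws' k)) → ∀ k → I e (lookup ws k)
  independent-of-run (w ∷ ws) (w' ∷ ws') rs tr (run-∷ tw r) ηe ηws I' k
    with ∷-injective ηws
  ... | ηw , ηws-tail with reflect rs tr tw ηe ηw (I' zero) | k
  ... | Iew | zero  = Iew
  ... | Iew | suc k' with diamond Iew tr tw
  ...   | _ , tw₁ , te₁ =
    independent-of-run ws ws' (reachable-step rs tw₁) te₁ r ηe ηws-tail (λ k → I' (suc k)) k'

  pairwise-independent-lift : ∀ {n s t} (es : Vec E n) (es' : Vec A'.E n) →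
                              Reachable s → Run s (toList es) t →
                              map η es ≡ map just es' → A'.PairwiseIndep es' → PairwiseIndep es
  pairwise-independent-lift (e ∷ es) (e' ∷ es') rs (run-∷ tr r) ηes I' zero (suc j) _
    with ∷-injective ηes
  ... | ηe , ηes-tail =
    independent-of-run es es' rs tr r ηe ηes-tail (λ k → I' zero (suc k) (s≤s z≤n)) j
  pairwise-independent-lift (e ∷ es) (e' ∷ es') rs (run-∷ tr r) ηes I' (suc i) (suc j) (s≤s i<j)
    with ∷-injective ηes
  ... | _ , ηes-tail =
    pairwise-independent-lift es es' (reachable-step rs tr) r ηes-tail
      (λ a b a<b → I' (suc a) (suc b) (s≤s a<b)) i j i<j

  Q-surjective : (n : ℕ) → QSurjective f n
  Q-surjective n s' es' (rs' , (t' , r') , I') with lift-reachable rs'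
  ... | s , rs , refl with lift-run s es' r'
  ... | es , t , r , _ , ηes =
    s , es , (rs , (t , r) , pairwise-independent-lift es es' rs r ηes I') , refl , ηes

mainTheorem4 : (A A' : AsyncSystem) (f : Morphism A A') → IsOpen f →
               (n : ℕ) → QSurjective f n
mainTheorem4 A A' f op = OpenMorphism.Q-surjective op
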